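{- Let $S$ be the system $x\approx p(x,x,y)\approx p(x,y,x)\approx p(y,x,x)\approx q(y,x,x)\approx q(x,y,x)\approx q(x,x,y)$ in ternary operation symbols $p,q$, and let $\Sigma$ be a proper subsystem of $S$ (a set of identities each equating two of the seven expressions listed, whose deductive closure does not contain all of $S$). If $\Sigma$ is satisfied by some term operations $p,q$ of the two-element semilattice $\langle\{0,1\},\wedge\rangle$, and $\Sigma$ is not satisfied by idempotent term operations of any module over any finite ring, then $\Sigma$ is equivalent, up to a permutation of the variables of the terms and interchanging the roles of $p$ and $q$, to the system $x\approx p(x,x,y)$, $\ p(x,y,x)\approx p(y,x,x)\approx q(y,x,x)\approx q(x,y,x)\approx q(x,x,y)$.
   Context: For a ring $R$ and an $R$-module $M$, the idempotent term operations of $M$ are the maps $(x_1,\dots,x_n)\mapsto\sum_i r_ix_i$ with $r_i\in R$ and $\sum_i r_i=1$. A permutation of the variables of $p$ means replacing $p(x_1,x_2,x_3)$ everywhere by $p(x_{\pi(1)},x_{\pi(2)},x_{\pi(3)})$ for a fixed permutation $\pi$, and similarly for $q$. -}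

module Defs where

open import Level using (0ℓ)
open import Data.Nat using (ℕ; zero; suc)
open import Data.Fin using (Fin; zero; suc)
open import Data.Fin.Permutation using (Permutation′; _⟨$⟩ʳ_)
open import Data.Bool using (Bool; true; false; _∧_; if_then_else_)
open import Data.Product using (Σ; ∃; _×_; _,_)
open import Relation.Binary.PropositionalEquality using (_≡_)
open import Relation.Nullary using (¬_)
open import Algebra.Bundles using (Ring)
open import Algebra.Module.Bundles using (LeftModule)

data Op : Set where
  P Q : Op

data Term : Set where
  var : ℕ → Term
  app : Op → Term → Term → Term → Term

x y : Term
x = var 0
y = var 1

p q : Term → Term → Term → Term
p = app P
q = app Q

expr : Fin 7 → Term
expr zero = x
expr (suc zero) = p x x y
expr (suc (suc zero)) = p x y x
expr (suc (suc (suc zero))) = p y x x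
expr (suc (suc (suc (suc zero)))) = q y x x
expr (suc (suc (suc (suc (suc zero))))) = q x y x
expr (suc (suc (suc (suc (suc (suc zero)))))) = q x x y

-- A system of identities, each equating two of the seven expressions:
-- Σ i j ≡ true means the identity  expr i ≈ expr j  belongs to the system.
System : Set
System = Fin 7 → Fin 7 → Bool

Axioms : Set₁
Axioms = Term → Term → Set

axioms : System → Axioms
axioms Sys s t = Σ (Fin 7) λ i → Σ (Fin 7) λ j →
  (Sys i j ≡ true) × (s ≡ expr i) × (t ≡ expr j)

subst : (ℕ → Term) → Term → Term
subst σ (var n) = σ n
subst σ (app o a b c) = app o (subst σ a) (subst σ b) (subst σ c)

data Derivable (Ax : Axioms) : Term → Term → Set where
  ax    : ∀ {s t} → Ax s t → Derivable Ax s t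
  refl  : ∀ {s} → Derivable Ax s s
  sym   : ∀ {s t} → Derivable Ax s t → Derivable Ax t s
  trans : ∀ {s t u} → Derivable Ax s t → Derivable Ax t u → Derivable Ax s u
  inst  : ∀ {s t} (σ : ℕ → Term) → Derivable Ax s t →
          Derivable Ax (subst σ s) (subst σ t)
  cong  : ∀ o {a b c a′ b′ c′} → Derivable Ax a a′ → Derivable Ax b b′ →
          Derivable Ax c c′ → Derivable Ax (app o a b c) (app o a′ b′ c′)

FullS : System
FullS _ _ = true

-- Σ is a proper subsystem of S: its deductive closure does not contain all of S.
-- (Every System is automatically a subset of S, since S equates all seven
-- expressions.)
Proper : System → Set
Proper Sys = ¬ (∀ i j → Derivable (axioms Sys) (expr i) (expr j))

Equivalent : Axioms → Axioms → Set
Equivalent A B = (∀ s t → Derivable A s t → Derivable B s t)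
               × (∀ s t → Derivable B s t → Derivable A s t)

-- The target system T:
--   x ≈ p(x,x,y),  p(x,y,x) ≈ p(y,x,x) ≈ q(y,x,x) ≈ q(x,y,x) ≈ q(x,x,y)

T : System
T zero (suc zero) = true
T (suc (suc zero)) (suc (suc (suc zero))) = true
T (suc (suc (suc zero))) (suc (suc (suc (suc zero)))) = true
T (suc (suc (suc (suc zero)))) (suc (suc (suc (suc (suc zero))))) = true
T (suc (suc (suc (suc (suc zero))))) (suc (suc (suc (suc (suc (suc zero)))))) = true
T _ _ = false

pick : Term → Term → Term → Fin 3 → Term
pick a b c zero = a
pick a b c (suc zero) = b
pick a b c (suc (suc zero)) = c

swapOp : Bool → Op → Op
swapOp false o = o
swapOp true P = Q
swapOp true Q = P

transform : Permutation′ 3 → Permutation′ 3 → Bool → Term → Term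
transform πp πq sw (var n) = var n
transform πp πq sw (app P a b c) =
  let a′ = transform πp πq sw a ; b′ = transform πp πq sw b ; c′ = transform πp πq sw c
      f = pick a′ b′ c′ in
  app (swapOp sw P) (f (πp ⟨$⟩ʳ zero)) (f (πp ⟨$⟩ʳ suc zero)) (f (πp ⟨$⟩ʳ suc (suc zero)))
transform πp πq sw (app Q a b c) =
  let a′ = transform πp πq sw a ; b′ = transform πp πq sw b ; c′ = transform πp πq sw c
      f = pick a′ b′ c′ in
  app (swapOp sw Q) (f (πq ⟨$⟩ʳ zero)) (f (πq ⟨$⟩ʳ suc zero)) (f (πq ⟨$⟩ʳ suc (suc zero)))

transformAxioms : Permutation′ 3 → Permutation′ 3 → Bool → Axioms → Axioms
transformAxioms πp πq sw A s t = Σ Term λ s₀ → Σ Term λ t₀ →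
  A s₀ t₀ × (s ≡ transform πp πq sw s₀) × (t ≡ transform πp πq sw t₀)

module _ {A : Set} where
  eval : (A → A → A → A) → (A → A → A → A) → (ℕ → A) → Term → A
  eval fp fq ρ (var n) = ρ n
  eval fp fq ρ (app P a b c) = fp (eval fp fq ρ a) (eval fp fq ρ b) (eval fp fq ρ c)
  eval fp fq ρ (app Q a b c) = fq (eval fp fq ρ a) (eval fp fq ρ b) (eval fp fq ρ c)

  Satisfies : (A → A → Set) → System → (A → A → A → A) → (A → A → A → A) → Set
  Satisfies _≈_ Sys fp fq = ∀ i j → Sys i j ≡ true → ∀ (ρ : ℕ → A) →
    eval fp fq ρ (expr i) ≈ eval fp fq ρ (expr j)

data SLTerm (n : ℕ) : Set where
  v   : Fin n → SLTerm n
  _⊓_ : SLTerm n → SLTerm n → SLTerm n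

evalSL : ∀ {n} → SLTerm n → (Fin n → Bool) → Bool
evalSL (v i) a = a i
evalSL (s ⊓ t) a = evalSL s a ∧ evalSL t a

ternary : SLTerm 3 → Bool → Bool → Bool → Bool
ternary t a b c = evalSL t (pick′ a b c)
  where
  pick′ : Bool → Bool → Bool → Fin 3 → Bool
  pick′ a b c zero = a
  pick′ a b c (suc zero) = b
  pick′ a b c (suc (suc zero)) = c

SatisfiedBySemilattice : System → Set
SatisfiedBySemilattice Sys = Σ (SLTerm 3) λ tp → Σ (SLTerm 3) λ tq →
  Satisfies _≡_ Sys (ternary tp) (ternary tq)

FiniteRing : Ring 0ℓ 0ℓ → Set
FiniteRing R = Σ ℕ λ n → Σ (Fin n → Ring.Carrier R) λ f →
  ∀ r → Σ (Fin n) λ i → Ring._≈_ R (f i) r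

Nontrivial : {R : Ring 0ℓ 0ℓ} → LeftModule R 0ℓ 0ℓ → Set
Nontrivial M = Σ (LeftModule.Carrierᴹ M) λ m → ¬ (LeftModule._≈ᴹ_ M m (LeftModule.0ᴹ M))

IdemCoeffs : Ring 0ℓ 0ℓ → Set
IdemCoeffs R = Σ (Fin 3 → Carrier) λ r →
  ((r zero + r (suc zero)) + r (suc (suc zero))) ≈ 1#
  where open Ring R using (Carrier; _+_; _≈_; 1#)

idemOp : {R : Ring 0ℓ 0ℓ} (M : LeftModule R 0ℓ 0ℓ) → IdemCoeffs R →
         let C = LeftModule.Carrierᴹ M in C → C → C → C
idemOp M (r , _) a b c =
  ((r zero *ₗ a) +ᴹ (r (suc zero) *ₗ b)) +ᴹ (r (suc (suc zero)) *ₗ c)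
  where open LeftModule M using (_+ᴹ_; _*ₗ_)

SatisfiedByModule : {R : Ring 0ℓ 0ℓ} → LeftModule R 0ℓ 0ℓ → System → Set
SatisfiedByModule {R} M Sys = Σ (IdemCoeffs R) λ cp → Σ (IdemCoeffs R) λ cq →
  Satisfies (LeftModule._≈ᴹ_ M) Sys (idemOp M cp) (idemOp M cq)

NotSatisfiedByFiniteRingModules : System → Set₁
NotSatisfiedByFiniteRingModules Sys =
  (R : Ring 0ℓ 0ℓ) → FiniteRing R → (M : LeftModule R 0ℓ 0ℓ) → Nontrivial M →
  ¬ SatisfiedByModule M Sys

-- Over the two-element semilattice a ternary term operation is the meet of the variables it
-- contains, so each of the seven expressions induces one of x, y, x ∧ y, and Σ identifies only
-- expressions inducing the same one. Over ℤ/5 an idempotent ternary operation is given by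
-- weights summing to 1, and each expression then denotes x + c (y - x) for a weight c. Weights
-- c with c = 0 at x, summing to 1 over the p-expressions and over the q-expressions, and
-- constant on the classes of a partition containing Σ, give a model of Σ. As 2 and 3 are units
-- mod 5 such weights exist, unless one of p, q is the meet of two variables and the other the
-- meet of all three. Then Σ lies inside the partition {x, e} | rest, where e is the expression
-- inducing x, and the same weight argument applied to the cuts of a block shows that Σ connects
-- both blocks. So Σ derives exactly the identities within the two blocks, and so does the
-- target system after the permutation of variables moving p(x,x,y) to e. The finitely many
-- cases are settled by computation.
module Submission where

open import Defs
open import Level using (0ℓ)
open import Algebra.Bundles using (Ring)
open import Algebra.Definitions using (Congruent₂)
open import Algebra.Module.Bundles using (LeftModule)
open import Algebra.Module.Construct.TensorUnit using (leftModule)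
open import Algebra.Structures using (IsRing)
open import Data.Bool using (Bool; true; false; not; _∧_; _∨_)
open import Data.Bool.Properties using (∧-identityʳ; ∧-zeroʳ) renaming (_≟_ to _≟ᵇ_)
open import Data.Empty using (⊥; ⊥-elim)
open import Data.Fin using (Fin; zero; suc; toℕ; fromℕ<)
open import Data.Fin.Permutation using (Permutation′; id; transpose)
open import Data.Fin.Properties using (toℕ-fromℕ<; all?; any?) renaming (_≟_ to _≟ᶠ_)
open import Data.Fin.Subset as Subset using (Subset; ⁅_⁆; _∪_; _∈_; _∉_; _⊆_; _⊂_; ∣_∣; Nonempty)
open import Data.Fin.Subset.Properties
  using (_∈?_; _⊂?_; nonempty?; anySubset?; x∈⁅x⁆; x∈⁅y⁆⇒x≡y; x∈p∪q⁺; x∈p∪q⁻; p⊆p∪q; p⊂q⇒∣p∣<∣q∣)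
open import Data.Nat as ℕ using (ℕ; zero; suc)
import Data.Nat.Properties as ℕ
open import Data.Product using (Σ; _×_; _,_; proj₁; proj₂)
open import Data.Product.Properties using (≡-dec)
open import Data.Sum using (_⊎_; inj₁; inj₂)
open import Data.Vec using ([]; _∷_; tabulate)
open import Data.Vec.Properties using (lookup∘tabulate; lookup⇒[]=; []=⇒lookup)
open import Function using (_∘_)
open import Relation.Binary.Definitions using (DecidableEquality)
open import Relation.Binary.PropositionalEquality as ≡ using (_≡_; refl)
open import Relation.Nullary using (Dec; yes; no; does; ¬_; contradiction)
open import Relation.Nullary.Decidable
  using (_×-dec_; _⊎-dec_; _→-dec_; ¬?; map′; decidable-stable; toWitness; dec-true)
open import Relation.Unary using (Pred; Decidable)

pattern e₀ = zero
pattern e₁ = suc e₀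
pattern e₂ = suc e₁
pattern e₃ = suc e₂
pattern e₄ = suc e₃
pattern e₅ = suc e₄
pattern e₆ = suc e₅

triple : {A : Set} → A → A → A → Fin 3 → A
triple a b c zero = a
triple a b c (suc zero) = b
triple a b c (suc (suc zero)) = c

module ℤmod (n : ℕ) where
  open import Data.Nat using (_+_; _*_; _%_)
  open import Data.Nat.Properties
    using (+-comm; +-assoc; +-identityʳ; *-comm; *-assoc; *-identityˡ; *-identityʳ; *-distribˡ-+; *-distribʳ-+)
  open import Data.Nat.DivMod using (%-distribˡ-+; %-distribˡ-*; m*n%n≡0; m%n<n; m%n%n≡m%n)

  private
    k : ℕ
    k = suc n

    _≈_ : ℕ → ℕ → Set
    a ≈ b = a % k ≡ b % k

    ≡⇒≈ : ∀ {a b} → a ≡ b → a ≈ b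
    ≡⇒≈ = ≡.cong (_% k)

    +-cong : Congruent₂ _≈_ _+_
    +-cong {a} {b} {c} {d} a≈b c≈d = begin
      (a + c) % k            ≡⟨ %-distribˡ-+ a c k ⟩
      (a % k + c % k) % k    ≡⟨ ≡.cong₂ (λ u w → (u + w) % k) a≈b c≈d ⟩
      (b % k + d % k) % k    ≡⟨ %-distribˡ-+ b d k ⟨
      (b + d) % k            ∎
      where open ≡.≡-Reasoning

    *-cong : Congruent₂ _≈_ _*_
    *-cong {a} {b} {c} {d} a≈b c≈d = begin
      (a * c) % k            ≡⟨ %-distribˡ-* a c k ⟩
      (a % k * (c % k)) % k  ≡⟨ ≡.cong₂ (λ u w → (u * w) % k) a≈b c≈d ⟩
      (b % k * (d % k)) % k  ≡⟨ %-distribˡ-* b d k ⟨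
      (b * d) % k            ∎
      where open ≡.≡-Reasoning

    -- negation is multiplication by n = k - 1, since n * a + a = a * k
    -_ : ℕ → ℕ
    - a = n * a

    -‿inverseˡ : ∀ a → (- a + a) ≈ 0
    -‿inverseˡ a = ≡.trans (≡⇒≈ (≡.trans (+-comm (n * a) a) (*-comm k a))) (m*n%n≡0 a k)

    isRing : IsRing _≈_ _+_ _*_ -_ 0 1
    isRing = record
      { +-isAbelianGroup = record
        { isGroup = record
          { isMonoid = record
            { isSemigroup = record
              { isMagma = record
                { isEquivalence = record { refl = refl ; sym = ≡.sym ; trans = ≡.trans }
                ; ∙-cong = λ {a} {b} {c} {d} → +-cong {a} {b} {c} {d} }
              ; assoc = λ a b c → ≡⇒≈ (+-assoc a b c) }
            ; identity = (λ _ → refl) , (λ a → ≡⇒≈ (+-identityʳ a)) }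
          ; inverse = -‿inverseˡ , λ a → ≡.trans (≡⇒≈ (+-comm a (n * a))) (-‿inverseˡ a)
          ; ⁻¹-cong = λ {a} {b} → *-cong {n} {n} {a} {b} refl }
        ; comm = λ a b → ≡⇒≈ (+-comm a b) }
      ; *-cong = λ {a} {b} {c} {d} → *-cong {a} {b} {c} {d}
      ; *-assoc = λ a b c → ≡⇒≈ (*-assoc a b c)
      ; *-identity = (λ a → ≡⇒≈ (*-identityˡ a)) , (λ a → ≡⇒≈ (*-identityʳ a))
      ; distrib = (λ a b c → ≡⇒≈ (*-distribˡ-+ a b c)) , (λ a b c → ≡⇒≈ (*-distribʳ-+ a b c)) }

  ring : Ring 0ℓ 0ℓ
  ring = record { isRing = isRing }

  finite : FiniteRing ring
  finite = k , toℕ , λ a → fromℕ< (m%n<n a k) , ≡.trans (≡.cong (_% k) (toℕ-fromℕ< (m%n<n a k))) (m%n%n≡m%n a k)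

-- Affine models over a ring

module AffineModel (R : Ring 0ℓ 0ℓ) where
  open Ring R renaming (refl to ≈-refl; sym to ≈-sym; trans to ≈-trans)
  open import Algebra.Properties.Ring R using (+-cancelʳ)
  open import Algebra.Properties.CommutativeSemigroup +-commutativeSemigroup using (xy∙z≈xz∙y; xy∙z≈yz∙x)
  open import Relation.Binary.Reasoning.Setoid setoid

  regular : LeftModule R 0ℓ 0ℓ
  regular = leftModule {R = R}

  -- c i is the weight of y in the value of expr i; the coefficients of p are then the weights of
  -- p(y,x,x), p(x,y,x), p(x,x,y), and those of q the weights of q(y,x,x), q(x,y,x), q(x,x,y).
  IsAffine : (Fin 7 → Carrier) → Set
  IsAffine c = (c e₀ ≈ 0#) × ((c e₃ + c e₂) + c e₁ ≈ 1#) × ((c e₄ + c e₅) + c e₆ ≈ 1#)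

  Affine : Carrier → Carrier → Carrier → Carrier → Set
  Affine x y u c = Σ Carrier λ a → (a + c ≈ 1#) × (u ≈ a * x + c * y)

  affine-unique : ∀ {x y u u′ c c′} → Affine x y u c → Affine x y u′ c′ → c ≈ c′ → u ≈ u′
  affine-unique {x} {y} {u} {u′} {c} {c′} (a , a+c≈1 , u≈) (a′ , a′+c′≈1 , u′≈) c≈c′ = begin
    u                ≈⟨ u≈ ⟩
    a * x + c * y    ≈⟨ +-cong (*-congʳ a≈a′) (*-congʳ c≈c′) ⟩
    a′ * x + c′ * y  ≈⟨ u′≈ ⟨
    u′               ∎
    where
    a≈a′ : a ≈ a′
    a≈a′ = +-cancelʳ c a a′ (≈-trans a+c≈1 (≈-trans (≈-sym a′+c′≈1) (+-congˡ (≈-sym c≈c′))))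

  affine-x : ∀ c x y → c ≈ 0# → Affine x y x c
  affine-x c x y c≈0 = 1# , ≈-trans (+-congˡ c≈0) (+-identityʳ 1#) , (begin
    x                ≈⟨ *-identityˡ x ⟨
    1# * x           ≈⟨ +-identityʳ (1# * x) ⟨
    1# * x + 0#      ≈⟨ +-congˡ (zeroˡ y) ⟨
    1# * x + 0# * y  ≈⟨ +-congˡ (*-congʳ c≈0) ⟨
    1# * x + c * y   ∎)

  affine-y-last : ∀ a b c x y → (a + b) + c ≈ 1# → Affine x y ((a * x + b * x) + c * y) c
  affine-y-last a b c x y sum≈1 = a + b , sum≈1 , +-congʳ (≈-sym (distribʳ x a b))

  affine-y-middle : ∀ a b c x y → (a + b) + c ≈ 1# → Affine x y ((a * x + b * y) + c * x) b
  affine-y-middle a b c x y sum≈1 = a + c , ≈-trans (xy∙z≈xz∙y a c b) sum≈1 , (begin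
    (a * x + b * y) + c * x  ≈⟨ xy∙z≈xz∙y (a * x) (b * y) (c * x) ⟩
    (a * x + c * x) + b * y  ≈⟨ +-congʳ (distribʳ x a c) ⟨
    (a + c) * x + b * y      ∎)

  affine-y-first : ∀ a b c x y → (a + b) + c ≈ 1# → Affine x y ((a * y + b * x) + c * x) a
  affine-y-first a b c x y sum≈1 = b + c , ≈-trans (≈-sym (xy∙z≈yz∙x a b c)) sum≈1 , (begin
    (a * y + b * x) + c * x  ≈⟨ xy∙z≈yz∙x (a * y) (b * x) (c * x) ⟩
    (b * x + c * x) + a * y  ≈⟨ +-congʳ (distribʳ x b c) ⟨
    (b + c) * x + a * y      ∎)

  affine-model : ∀ {Sys c} → IsAffine c → (∀ {i j} → Sys i j ≡ true → c i ≈ c j) →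
                 SatisfiedByModule regular Sys
  affine-model {Sys} {c} (c₀≈0 , p-sum , q-sum) respects = cp , cq , λ i j ij∈Sys ρ →
    affine-unique (expr-affine i ρ) (expr-affine j ρ) (respects ij∈Sys)
    where
    cp cq : IdemCoeffs R
    cp = triple (c e₃) (c e₂) (c e₁) , p-sum
    cq = triple (c e₄) (c e₅) (c e₆) , q-sum

    expr-affine : ∀ i ρ → Affine (ρ 0) (ρ 1) (eval (idemOp regular cp) (idemOp regular cq) ρ (expr i)) (c i)
    expr-affine e₀ ρ = affine-x (c e₀) (ρ 0) (ρ 1) c₀≈0
    expr-affine e₁ ρ = affine-y-last _ _ _ (ρ 0) (ρ 1) p-sum
    expr-affine e₂ ρ = affine-y-middle _ _ _ (ρ 0) (ρ 1) p-sum
    expr-affine e₃ ρ = affine-y-first _ _ _ (ρ 0) (ρ 1) p-sum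
    expr-affine e₄ ρ = affine-y-first _ _ _ (ρ 0) (ρ 1) q-sum
    expr-affine e₅ ρ = affine-y-middle _ _ _ (ρ 0) (ρ 1) q-sum
    expr-affine e₆ ρ = affine-y-last _ _ _ (ρ 0) (ρ 1) q-sum

Respects : {B : Set} → System → (Fin 7 → B) → Set
Respects Sys g = ∀ {i j} → Sys i j ≡ true → g i ≡ g j

Finer : {B C : Set} → (Fin 7 → B) → (Fin 7 → C) → Set
Finer g h = ∀ i j → g i ≡ g j → h i ≡ h j

ℤ₅ : Ring 0ℓ 0ℓ
ℤ₅ = ℤmod.ring 4

IsAffine₅ : (Fin 7 → ℕ) → Set
IsAffine₅ = AffineModel.IsAffine ℤ₅

isAffine₅? : ∀ c → Dec (IsAffine₅ c)
isAffine₅? c = (_ ℕ.≟ _) ×-dec (_ ℕ.≟ _) ×-dec (_ ℕ.≟ _)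

Weights : Set
Weights = Fin 5 × Fin 5 × Fin 5 × Fin 5

_⟨_⟩ : Weights → Bool × Bool → ℕ
(a , _ , _ , _) ⟨ true  , true  ⟩ = toℕ a
(_ , b , _ , _) ⟨ true  , false ⟩ = toℕ b
(_ , _ , c , _) ⟨ false , true  ⟩ = toℕ c
(_ , _ , _ , d) ⟨ false , false ⟩ = toℕ d

AffineVia : (Fin 7 → Bool × Bool) → Set
AffineVia g = Σ Weights λ f → IsAffine₅ (λ i → f ⟨ g i ⟩)

affineVia? : ∀ g → Dec (AffineVia g)
affineVia? g =
  map′ (λ (a , b , c , d , aff) → (a , b , c , d) , aff) (λ ((a , b , c , d) , aff) → a , b , c , d , aff)
       (any? λ a → any? λ b → any? λ c → any? λ d → isAffine₅? (λ i → (a , b , c , d) ⟨ g i ⟩))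

module Refutation {Sys : System} (no-model : NotSatisfiedByFiniteRingModules Sys) where
  open AffineModel ℤ₅ using (regular; affine-model)

  no-affine-labelling : ∀ {c} → IsAffine₅ c → Respects Sys c → ⊥
  no-affine-labelling {c} affine respects =
    no-model ℤ₅ (ℤmod.finite 4) regular (1 , λ ()) (affine-model {Sys} {c} affine (≡.cong (ℕ._% 5) ∘ respects))

  no-affine-via : ∀ {g} → AffineVia g → Respects Sys g → ⊥
  no-affine-via (f , affine) respects = no-affine-labelling affine (≡.cong (f ⟨_⟩) ∘ respects)

-- The semilattice

meetOf : ∀ {n} → Subset n → (Fin n → Bool) → Bool
meetOf [] a = true
meetOf (s ∷ S) a = (not s ∨ a zero) ∧ meetOf S (a ∘ suc)

meetOf-cong : ∀ {n} (S : Subset n) {a b} → (∀ i → a i ≡ b i) → meetOf S a ≡ meetOf S b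
meetOf-cong [] a≗b = refl
meetOf-cong (s ∷ S) a≗b = ≡.cong₂ (λ u w → (not s ∨ u) ∧ w) (a≗b zero) (meetOf-cong S (a≗b ∘ suc))

meetOf-⊥ : ∀ {n} a → meetOf (Subset.⊥ {n}) a ≡ true
meetOf-⊥ {zero} a = refl
meetOf-⊥ {suc n} a = meetOf-⊥ (a ∘ suc)

meetOf-⁅⁆ : ∀ {n} (i : Fin n) a → meetOf ⁅ i ⁆ a ≡ a i
meetOf-⁅⁆ zero a = ≡.trans (≡.cong (a zero ∧_) (meetOf-⊥ (a ∘ suc))) (∧-identityʳ (a zero))
meetOf-⁅⁆ (suc i) a = meetOf-⁅⁆ i (a ∘ suc)

meetOf-∪ : ∀ {n} (S S′ : Subset n) a → meetOf (S ∪ S′) a ≡ meetOf S a ∧ meetOf S′ a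
meetOf-∪ [] [] a = refl
meetOf-∪ (s ∷ S) (s′ ∷ S′) a rewrite meetOf-∪ S S′ (a ∘ suc) = distrib s s′ (a zero)
  where
  distrib : ∀ s s′ b {m m′} → (not (s ∨ s′) ∨ b) ∧ (m ∧ m′) ≡ ((not s ∨ b) ∧ m) ∧ ((not s′ ∨ b) ∧ m′)
  distrib true  true  true  = refl
  distrib true  true  false = refl
  distrib true  false true  = refl
  distrib true  false false = refl
  distrib false true  true  = refl
  distrib false true  false {m} = ≡.sym (∧-zeroʳ m)
  distrib false false b     = refl

support : ∀ {n} → SLTerm n → Subset n
support (v i) = ⁅ i ⁆
support (s ⊓ t) = support s ∪ support t

evalSL-meetOf : ∀ {n} (t : SLTerm n) a → evalSL t a ≡ meetOf (support t) a
evalSL-meetOf (v i) a = ≡.sym (meetOf-⁅⁆ i a)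
evalSL-meetOf (s ⊓ t) a =
  ≡.trans (≡.cong₂ _∧_ (evalSL-meetOf s a) (evalSL-meetOf t a)) (≡.sym (meetOf-∪ (support s) (support t) a))

support-nonempty : ∀ {n} (t : SLTerm n) → Nonempty (support t)
support-nonempty (v i) = i , x∈⁅x⁆ i
support-nonempty (s ⊓ t) = let i , i∈s = support-nonempty s in i , x∈p∪q⁺ (inj₁ i∈s)

⋀ : Subset 3 → Bool → Bool → Bool → Bool
⋀ S a b c = meetOf S (triple a b c)

ternary-⋀ : ∀ t a b c → ternary t a b c ≡ ⋀ (support t) a b c
ternary-⋀ t a b c = ≡.trans (evalSL-meetOf t _) (meetOf-cong (support t) λ
  { zero → refl ; (suc zero) → refl ; (suc (suc zero)) → refl })

eval-cong : {A : Set} {fp fp′ fq fq′ : A → A → A → A} →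
            (∀ a b c → fp a b c ≡ fp′ a b c) → (∀ a b c → fq a b c ≡ fq′ a b c) →
            ∀ ρ t → eval fp fq ρ t ≡ eval fp′ fq′ ρ t
eval-cong p≗ q≗ ρ (var n) = refl
eval-cong p≗ q≗ ρ (app P a b c)
  rewrite eval-cong p≗ q≗ ρ a | eval-cong p≗ q≗ ρ b | eval-cong p≗ q≗ ρ c = p≗ _ _ _
eval-cong p≗ q≗ ρ (app Q a b c)
  rewrite eval-cong p≗ q≗ ρ a | eval-cong p≗ q≗ ρ b | eval-cong p≗ q≗ ρ c = q≗ _ _ _

satisfies-cong : ∀ {Sys} {fp fp′ fq fq′ : Bool → Bool → Bool → Bool} →
                 (∀ a b c → fp a b c ≡ fp′ a b c) → (∀ a b c → fq a b c ≡ fq′ a b c) →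
                 Satisfies _≡_ Sys fp fq → Satisfies _≡_ Sys fp′ fq′
satisfies-cong p≗ q≗ sat i j ij∈Sys ρ =
  ≡.trans (≡.sym (eval-cong p≗ q≗ ρ (expr i))) (≡.trans (sat i j ij∈Sys ρ) (eval-cong p≗ q≗ ρ (expr j)))

atX atY : ℕ → Bool
atX zero = true
atX (suc _) = false
atY = not ∘ atX

-- Over the semilattice each expression induces one of the binary operations x, y, x ∧ y,
-- which is determined by its values at (x , y) = (1 , 0) and (0 , 1).
binary : (fp fq : Bool → Bool → Bool → Bool) → Fin 7 → Bool × Bool
binary fp fq i = eval fp fq atX (expr i) , eval fp fq atY (expr i)

satisfies⇒respects-binary : ∀ {Sys fp fq} → Satisfies _≡_ Sys fp fq → Respects Sys (binary fp fq)
satisfies⇒respects-binary sat {i} {j} ij∈Sys = ≡.cong₂ _,_ (sat i j ij∈Sys atX) (sat i j ij∈Sys atY)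

semilattice-respects : ∀ {Sys} tp tq → Satisfies _≡_ Sys (ternary tp) (ternary tq) →
                       Respects Sys (binary (⋀ (support tp)) (⋀ (support tq)))
semilattice-respects tp tq = satisfies⇒respects-binary ∘ satisfies-cong (ternary-⋀ tp) (ternary-⋀ tq)

-- Decisions by enumeration

allSubsets? : ∀ {n ℓ} {P : Pred (Subset n) ℓ} → Decidable P → Dec (∀ S → P S)
allSubsets? P? = map′ (λ ¬counterexample S → decidable-stable (P? S) (λ ¬PS → ¬counterexample (S , ¬PS)))
                      (λ all (S , ¬PS) → ¬PS (all S))
                      (¬? (anySubset? (¬? ∘ P?)))

allBool? : ∀ {ℓ} {P : Pred Bool ℓ} → Decidable P → Dec (∀ b → P b)
allBool? P? = map′ (λ (Pt , Pf) → λ { true → Pt ; false → Pf }) (λ all → all true , all false) (P? true ×-dec P? false)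

fibre : ∀ {n} → (Fin n → Bool) → Bool → Subset n
fibre g b = tabulate (λ i → does (g i ≟ᵇ b))

∈-fibre⁺ : ∀ {n} {g : Fin n → Bool} {b i} → g i ≡ b → i ∈ fibre g b
∈-fibre⁺ {g = g} {b} {i} gi≡b =
  lookup⇒[]= i _ (≡.trans (lookup∘tabulate (λ j → does (g j ≟ᵇ b)) i) (dec-true (g i ≟ᵇ b) gi≡b))

∈-fibre⁻ : ∀ {n} {g : Fin n → Bool} {b i} → i ∈ fibre g b → g i ≡ b
∈-fibre⁻ {g = g} {b} {i} i∈
  with g i ≟ᵇ b | ≡.trans (≡.sym (lookup∘tabulate (λ j → does (g j ≟ᵇ b)) i)) ([]=⇒lookup i∈)
... | yes gi≡b | _ = gi≡b
... | no _ | ()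

xBlock : Fin 6 → Fin 7 → Bool
xBlock e zero = true
xBlock e (suc i) = does (i ≟ᶠ e)

finer? : (g : Fin 7 → Bool × Bool) (h : Fin 7 → Bool) → Dec (Finer g h)
finer? g h = all? λ i → all? λ j → ≡-dec _≟ᵇ_ _≟ᵇ_ (g i) (g j) →-dec h i ≟ᵇ h j

opaque
  semilattice-dichotomy : ∀ Sp Sq → Nonempty Sp → Nonempty Sq →
    AffineVia (binary (⋀ Sp) (⋀ Sq)) ⊎ Σ (Fin 6) λ e → Finer (binary (⋀ Sp) (⋀ Sq)) (xBlock e)
  semilattice-dichotomy = toWitness {a? = allSubsets? λ Sp → allSubsets? λ Sq →
    nonempty? Sp →-dec nonempty? Sq →-dec
    (affineVia? (binary (⋀ Sp) (⋀ Sq)) ⊎-dec any? λ e → finer? (binary (⋀ Sp) (⋀ Sq)) (xBlock e))} _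

opaque
  cut-dichotomy : ∀ e b D → Nonempty D → D ⊂ fibre (xBlock e) b → AffineVia (λ i → xBlock e i , does (i ∈? D))
  cut-dichotomy = toWitness {a? = all? λ e → allBool? λ b → allSubsets? λ D →
    nonempty? D →-dec D ⊂? fibre (xBlock e) b →-dec affineVia? (λ i → xBlock e i , does (i ∈? D))} _

-- Connectivity through cuts

module _ {n} (_~_ : Fin n → Fin n → Set) where

  Leaves : Subset n → Subset n → Set
  Leaves C D = Σ (Fin n) λ u → Σ (Fin n) λ w → u ∈ D × w ∈ C × w ∉ D × u ~ w

  reach-through-cuts : (∀ {i j k} → i ~ j → j ~ k → i ~ k) →
                       ∀ (C : Subset n) {i} → i ∈ C → i ~ i → (∀ D → i ∈ D → D ⊂ C → Leaves C D) →
                       ∀ {j} → j ∈ C → i ~ j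
  reach-through-cuts ~-trans C {i} i∈C i~i leave = grow ∣ C ∣ ⁅ i ⁆ (x∈⁅x⁆ i) ⁅i⁆⊆C (ℕ.m≤m+n ∣ C ∣ ∣ ⁅ i ⁆ ∣) reach-i
    where
    ⁅i⁆⊆C : ⁅ i ⁆ ⊆ C
    ⁅i⁆⊆C j∈⁅i⁆ rewrite x∈⁅y⁆⇒x≡y i j∈⁅i⁆ = i∈C

    reach-i : ∀ {j} → j ∈ ⁅ i ⁆ → i ~ j
    reach-i j∈⁅i⁆ rewrite x∈⁅y⁆⇒x≡y i j∈⁅i⁆ = i~i

    grow : ∀ k D → i ∈ D → D ⊆ C → ∣ C ∣ ℕ.≤ k ℕ.+ ∣ D ∣ → (∀ {j} → j ∈ D → i ~ j) →
           ∀ {j} → j ∈ C → i ~ j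
    grow k D i∈D D⊆C size reach {j} j∈C with j ∈? D
    ... | yes j∈D = reach j∈D
    ... | no j∉D = extend k size (leave D i∈D D⊂C)
      where
      D⊂C : D ⊂ C
      D⊂C = D⊆C , j , j∈C , j∉D

      extend : ∀ k → ∣ C ∣ ℕ.≤ k ℕ.+ ∣ D ∣ → Leaves C D → i ~ j
      extend zero size _ = contradiction size (ℕ.<⇒≱ (p⊂q⇒∣p∣<∣q∣ D⊂C))
      extend (suc k) size (u , w , u∈D , w∈C , w∉D , u~w) =
        grow k (D ∪ ⁅ w ⁆) (p⊆p∪q ⁅ w ⁆ i∈D) D′⊆C size′ reach′ j∈C
        where
        w∈D′ : w ∈ D ∪ ⁅ w ⁆
        w∈D′ = x∈p∪q⁺ (inj₂ (x∈⁅x⁆ w))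

        D′⊆C : D ∪ ⁅ w ⁆ ⊆ C
        D′⊆C x∈D′ with x∈p∪q⁻ D ⁅ w ⁆ x∈D′
        ... | inj₁ x∈D = D⊆C x∈D
        ... | inj₂ x∈⁅w⁆ rewrite x∈⁅y⁆⇒x≡y w x∈⁅w⁆ = w∈C

        reach′ : ∀ {x} → x ∈ D ∪ ⁅ w ⁆ → i ~ x
        reach′ x∈D′ with x∈p∪q⁻ D ⁅ w ⁆ x∈D′
        ... | inj₁ x∈D = reach x∈D
        ... | inj₂ x∈⁅w⁆ rewrite x∈⁅y⁆⇒x≡y w x∈⁅w⁆ = ~-trans (reach u∈D) u~w

        size′ : ∣ C ∣ ℕ.≤ k ℕ.+ ∣ D ∪ ⁅ w ⁆ ∣
        size′ = begin
          ∣ C ∣                ≤⟨ size ⟩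
          suc k ℕ.+ ∣ D ∣      ≡⟨ ℕ.+-suc k ∣ D ∣ ⟨
          k ℕ.+ suc ∣ D ∣      ≤⟨ ℕ.+-monoʳ-≤ k (p⊂q⇒∣p∣<∣q∣ (p⊆p∪q ⁅ w ⁆ , w , w∈D′ , w∉D)) ⟩
          k ℕ.+ ∣ D ∪ ⁅ w ⁆ ∣  ∎
          where open ℕ.≤-Reasoning

derivable-mono : {A B : Axioms} → (∀ s t → A s t → Derivable B s t) → ∀ s t → Derivable A s t → Derivable B s t
derivable-mono A⇒B s t (ax st) = A⇒B s t st
derivable-mono A⇒B s s refl = refl
derivable-mono A⇒B s t (sym d) = sym (derivable-mono A⇒B t s d)
derivable-mono A⇒B s t (trans {t = u} d d′) = trans (derivable-mono A⇒B s u d) (derivable-mono A⇒B u t d′)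
derivable-mono A⇒B _ _ (inst σ d) = inst σ (derivable-mono A⇒B _ _ d)
derivable-mono A⇒B _ _ (cong o d₁ d₂ d₃) =
  cong o (derivable-mono A⇒B _ _ d₁) (derivable-mono A⇒B _ _ d₂) (derivable-mono A⇒B _ _ d₃)

WithinBlocks : Axioms → (Fin 7 → Bool) → Set
WithinBlocks A κ = ∀ s t → A s t → Σ (Fin 7) λ i → Σ (Fin 7) λ j → s ≡ expr i × t ≡ expr j × κ i ≡ κ j

ConnectsBlocks : Axioms → (Fin 7 → Bool) → Set
ConnectsBlocks B κ = ∀ {i j} → κ i ≡ κ j → Derivable B (expr i) (expr j)

derivable-within-blocks : ∀ {A B κ} → WithinBlocks A κ → ConnectsBlocks B κ →
                          ∀ s t → Derivable A s t → Derivable B s t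
derivable-within-blocks {B = B} within connects = derivable-mono λ s t st →
  let i , j , s≡i , t≡j , κi≡κj = within s t st
  in ≡.subst₂ (Derivable B) (≡.sym s≡i) (≡.sym t≡j) (connects κi≡κj)

equivalent-by-blocks : ∀ {A B κ} → WithinBlocks A κ → ConnectsBlocks A κ → WithinBlocks B κ → ConnectsBlocks B κ →
                       Equivalent A B
equivalent-by-blocks A-within A-connects B-within B-connects =
  derivable-within-blocks A-within B-connects , derivable-within-blocks B-within A-connects

module TwoBlocks {Sys : System} (no-model : NotSatisfiedByFiniteRingModules Sys)
                 (e : Fin 6) (respects : Respects Sys (xBlock e)) where
  open Refutation no-model

  _~_ : Fin 7 → Fin 7 → Set
  i ~ j = Derivable (axioms Sys) (expr i) (expr j)

  Edge : Fin 7 → Fin 7 → Set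
  Edge u w = Sys u w ≡ true ⊎ Sys w u ≡ true

  edge⇒~ : ∀ {u w} → Edge u w → u ~ w
  edge⇒~ {u} {w} (inj₁ uw) = ax (u , w , uw , refl , refl)
  edge⇒~ {u} {w} (inj₂ wu) = sym (ax (w , u , wu , refl , refl))

  edge-respects : ∀ {u w} → Edge u w → xBlock e u ≡ xBlock e w
  edge-respects (inj₁ uw) = respects uw
  edge-respects (inj₂ wu) = ≡.sym (respects wu)

  Crossing : Subset 7 → Set
  Crossing D = Σ (Fin 7) λ u → Σ (Fin 7) λ w → u ∈ D × w ∉ D × Edge u w

  crossing? : ∀ D → Dec (Crossing D)
  crossing? D = any? λ u → any? λ w → u ∈? D ×-dec ¬? (w ∈? D) ×-dec (Sys u w ≟ᵇ true ⊎-dec Sys w u ≟ᵇ true)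

  uncrossed-respects : ∀ D → ¬ Crossing D → Respects Sys (λ i → does (i ∈? D))
  uncrossed-respects D uncrossed {u} {w} uw with u ∈? D | w ∈? D
  ... | yes _   | yes _   = refl
  ... | no _    | no _    = refl
  ... | yes u∈D | no w∉D  = contradiction (u , w , u∈D , w∉D , inj₁ uw) uncrossed
  ... | no u∉D  | yes w∈D = contradiction (w , u , w∈D , u∉D , inj₂ uw) uncrossed

  crossing : ∀ b D → Nonempty D → D ⊂ fibre (xBlock e) b → Crossing D
  crossing b D nonempty D⊂ = decidable-stable (crossing? D) λ uncrossed →
    no-affine-via (cut-dichotomy e b D nonempty D⊂)
                  (λ ij → ≡.cong₂ _,_ (respects ij) (uncrossed-respects D uncrossed ij))

  connects : ConnectsBlocks (axioms Sys) (xBlock e)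
  connects {i} κi≡κj =
    reach-through-cuts _~_ trans C (∈-fibre⁺ {g = xBlock e} refl) refl leave (∈-fibre⁺ {g = xBlock e} (≡.sym κi≡κj))
    where
    C : Subset 7
    C = fibre (xBlock e) (xBlock e i)

    leave : ∀ D → i ∈ D → D ⊂ C → Leaves _~_ C D
    leave D i∈D D⊂C =
      let u , w , u∈D , w∉D , uw = crossing (xBlock e i) D (i , i∈D) D⊂C
          κu≡κi = ∈-fibre⁻ {g = xBlock e} {b = xBlock e i} (proj₁ D⊂C u∈D)
      in u , w , u∈D , ∈-fibre⁺ {g = xBlock e} (≡.trans (≡.sym (edge-respects uw)) κu≡κi) , w∉D , edge⇒~ uw

  within : WithinBlocks (axioms Sys) (xBlock e)
  within _ _ (i , j , ij , refl , refl) = i , j , refl , refl , respects ij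

-- The target system

_≟ᵒ_ : DecidableEquality Op
P ≟ᵒ P = yes refl
P ≟ᵒ Q = no λ ()
Q ≟ᵒ P = no λ ()
Q ≟ᵒ Q = yes refl

_≟ᵗ_ : DecidableEquality Term
var m ≟ᵗ var n = map′ (≡.cong var) (λ { refl → refl }) (m ℕ.≟ n)
var _ ≟ᵗ app _ _ _ _ = no λ ()
app _ _ _ _ ≟ᵗ var _ = no λ ()
app o a b c ≟ᵗ app o′ a′ b′ c′ =
  map′ (λ { (refl , refl , refl , refl) → refl }) (λ { refl → refl , refl , refl , refl })
       (o ≟ᵒ o′ ×-dec a ≟ᵗ a′ ×-dec b ≟ᵗ b′ ×-dec c ≟ᵗ c′)

opaque
  T-respects : Respects T (xBlock zero)
  T-respects {i} {j} =
    toWitness {a? = all? λ i → all? λ j → (T i j ≟ᵇ true) →-dec (xBlock zero i ≟ᵇ xBlock zero j)} _ i j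

module _ (πp πq : Permutation′ 3) (sw : Bool) where
  private
    ⟦_⟧ : Fin 7 → Term
    ⟦ u ⟧ = transform πp πq sw (expr u)

    _~_ : Term → Term → Set
    _~_ = Derivable (transformAxioms πp πq sw (axioms T))

    step : ∀ u w → T u w ≡ true → ⟦ u ⟧ ~ ⟦ w ⟧
    step u w uw = ax (expr u , expr w , (u , w , uw , refl , refl) , refl , refl)

    root : Bool → Fin 7
    root true = e₀
    root false = e₂

    from-root : ∀ u → ⟦ root (xBlock zero u) ⟧ ~ ⟦ u ⟧
    from-root e₀ = refl
    from-root e₁ = step e₀ e₁ refl
    from-root e₂ = refl
    from-root e₃ = step e₂ e₃ refl
    from-root e₄ = trans (step e₂ e₃ refl) (step e₃ e₄ refl)
    from-root e₅ = trans (trans (step e₂ e₃ refl) (step e₃ e₄ refl)) (step e₄ e₅ refl)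
    from-root e₆ = trans (trans (trans (step e₂ e₃ refl) (step e₃ e₄ refl)) (step e₄ e₅ refl)) (step e₅ e₆ refl)

  transformed-T-connected : ∀ {u w} → xBlock zero u ≡ xBlock zero w → ⟦ u ⟧ ~ ⟦ w ⟧
  transformed-T-connected {u} {w} κu≡κw =
    trans (sym (from-root u)) (≡.subst (λ b → ⟦ root b ⟧ ~ ⟦ w ⟧) (≡.sym κu≡κw) (from-root w))

-- the permutation of the variables of p, and whether p and q are interchanged,
-- that move x ≈ p(x,x,y) to x ≈ expr (suc e)
target : Fin 6 → Permutation′ 3 × Bool
target zero = id , false
target (suc zero) = transpose (suc zero) (suc (suc zero)) , false
target (suc (suc zero)) = transpose zero (suc (suc zero)) , false
target (suc (suc (suc zero))) = transpose zero (suc (suc zero)) , true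
target (suc (suc (suc (suc zero)))) = transpose (suc zero) (suc (suc zero)) , true
target (suc (suc (suc (suc (suc zero))))) = id , true

transformᵉ : Fin 6 → Term → Term
transformᵉ e = transform (proj₁ (target e)) id (proj₂ (target e))

transformed-T : Fin 6 → Axioms
transformed-T e = transformAxioms (proj₁ (target e)) id (proj₂ (target e)) (axioms T)

opaque
  transform-onto : ∀ e i → Σ (Fin 7) λ u → transformᵉ e (expr u) ≡ expr i × xBlock zero u ≡ xBlock e i
  transform-onto = toWitness {a? = all? λ e → all? λ i → any? λ u →
    (transformᵉ e (expr u) ≟ᵗ expr i) ×-dec (xBlock zero u ≟ᵇ xBlock e i)} _

opaque
  transform-into : ∀ e u → Σ (Fin 7) λ i → transformᵉ e (expr u) ≡ expr i × xBlock e i ≡ xBlock zero u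
  transform-into = toWitness {a? = all? λ e → all? λ u → any? λ i →
    (transformᵉ e (expr u) ≟ᵗ expr i) ×-dec (xBlock e i ≟ᵇ xBlock zero u)} _

transformed-T-within : ∀ e → WithinBlocks (transformed-T e) (xBlock e)
transformed-T-within e _ _ (_ , _ , (u , w , uw , refl , refl) , refl , refl) =
  let i , u↦i , κi≡κu = transform-into e u
      j , w↦j , κj≡κw = transform-into e w
  in i , j , u↦i , w↦j , ≡.trans κi≡κu (≡.trans (T-respects uw) (≡.sym κj≡κw))

transformed-T-connects : ∀ e → ConnectsBlocks (transformed-T e) (xBlock e)
transformed-T-connects e {i} {j} κi≡κj =
  let u , u↦i , κu≡κi = transform-onto e i
      w , w↦j , κw≡κj = transform-onto e j
  in ≡.subst₂ (Derivable (transformed-T e)) u↦i w↦j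
       (transformed-T-connected (proj₁ (target e)) id (proj₂ (target e))
         (≡.trans κu≡κi (≡.trans κi≡κj (≡.sym κw≡κj))))

mainTheorem11 : (Sys : System) → Proper Sys → SatisfiedBySemilattice Sys →
                NotSatisfiedByFiniteRingModules Sys →
                Σ (Permutation′ 3) λ πp → Σ (Permutation′ 3) λ πq → Σ Bool λ sw →
                  Equivalent (axioms Sys) (transformAxioms πp πq sw (axioms T))
mainTheorem11 Sys _ (tp , tq , sat) no-model
  with semilattice-dichotomy (support tp) (support tq) (support-nonempty tp) (support-nonempty tq)
... | inj₁ affine = ⊥-elim (Refutation.no-affine-via no-model affine (semilattice-respects tp tq sat))
... | inj₂ (e , finer) =
  proj₁ (target e) , id , proj₂ (target e) ,
  equivalent-by-blocks within connects (transformed-T-within e) (transformed-T-connects e)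
  where open TwoBlocks no-model e (λ {i} {j} ij → finer i j (semilattice-respects tp tq sat ij))
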